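{- Let $(W,S,(\leqslant_i)_{i=1,\dots,M})$ be a component-wise ordered similarity space. Let $A,B\subseteq W$ be orthotopes with $A\cap B\neq\emptyset$ and let $c\in V$. Then $U_c(A\cap B)=U_c(A)\cap U_c(B)$.
   Context: $V\subseteq[0,1]$ is finite with $0,1\in V$, and $\odot$ is an associative, commutative binary operation on $V$ with neutral element $1$, monotone in both arguments. A similarity space is $(W,S)$ with $W\neq\emptyset$, $S\colon W^2\to V$, $S(u,v)=1$ iff $u=v$, $S$ symmetric, $S(u,w)\geq S(u,v)\odot S(v,w)$. A totally ordered similarity space $(W_i,S_i,\sqsubseteq_i)$ is a finite similarity space with a total order $\sqsubseteq_i$ such that $u\sqsubseteq_i v\sqsubseteq_i w$ implies $\min(S_i(u,v),S_i(v,w))\geq S_i(u,w)$. Given such spaces for $i=1,\dots,M$, the component-wise ordered similarity space has $W=\prod_iW_i$, $S(v,w)=\min_iS_i(v_i,w_i)$, and preorders $v\leqslant_i w$ iff $v_i\sqsubseteq_i w_i$. An interval of $W_i$ is a set $\{w\in W_i:u\sqsubseteq_i w\sqsubseteq_i v\}$ with $u\sqsubseteq_i v$; an orthotope of $W$ is a Cartesian product $I_1\times\dots\times I_M$ of intervals $I_i$ of $W_i$. $U_c(A)=\{w\in W:\exists a\in A,\ S(w,a)\geq c\}$. -}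

module Defs where

open import Data.Nat using (ℕ; zero; suc)
open import Data.Fin using (Fin; zero; suc; fromℕ; toℕ; _≤_)
open import Data.Nat using (_≤ᵇ_)
open import Data.Bool using (if_then_else_)
open import Data.Product using (Σ; _×_; _,_; ∃; ∃-syntax)
open import Function.Bundles using (_⇔_; _↔_)
open import Relation.Binary.PropositionalEquality using (_≡_)
open import Relation.Binary.Structures using (IsTotalOrder)
open import Relation.Unary using (Pred; _∩_)
open import Level using (0ℓ)

-- V is a finite subset of [0,1] containing 0 and 1.  Only its order
-- structure (and ⊙) is ever used, and every such V is order-isomorphic
-- to Fin (2 + n) for some n (with 0 ↦ zero, 1 ↦ the top element).
-- So we model V as Fin (suc (suc n)) with the usual order of Fin.

V : ℕ → Set
V n = Fin (suc (suc n))

𝟘 : ∀ {n} → V n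
𝟘 = zero

𝟙 : ∀ {n} → V n
𝟙 {n} = fromℕ (suc n)

_⊓ᵛ_ : ∀ {n} → V n → V n → V n
a ⊓ᵛ b = if toℕ a ≤ᵇ toℕ b then a else b

minᵛ : ∀ {n M} → (Fin M → V n) → V n
minᵛ {M = zero}  f = 𝟙
minᵛ {M = suc M} f = f zero ⊓ᵛ minᵛ (λ i → f (suc i))

record IsConjunction (n : ℕ) (_⊙_ : V n → V n → V n) : Set where
  field
    assoc    : ∀ a b c → (a ⊙ b) ⊙ c ≡ a ⊙ (b ⊙ c)
    comm     : ∀ a b → a ⊙ b ≡ b ⊙ a
    identityˡ : ∀ a → 𝟙 ⊙ a ≡ a
    identityʳ : ∀ a → a ⊙ 𝟙 ≡ a
    mono     : ∀ {a a′ b b′} → a ≤ a′ → b ≤ b′ → (a ⊙ b) ≤ (a′ ⊙ b′)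

record IsSimilarity {n : ℕ} (_⊙_ : V n → V n → V n)
                    (W : Set) (S : W → W → V n) : Set where
  field
    inhabited : W
    S-one     : ∀ u v → (S u v ≡ 𝟙) ⇔ (u ≡ v)
    S-sym     : ∀ u v → S u v ≡ S v u
    S-trans   : ∀ u v w → (S u v ⊙ S v w) ≤ S u w

record TOSimilaritySpace {n : ℕ} (_⊙_ : V n → V n → V n) : Set₁ where
  field
    Carrier   : Set
    S         : Carrier → Carrier → V n
    _⊑_       : Carrier → Carrier → Set
    isSim     : IsSimilarity _⊙_ Carrier S
    size      : ℕ
    finite    : Carrier ↔ Fin size
    isTotal   : IsTotalOrder _≡_ _⊑_
    convex    : ∀ {u v w} → u ⊑ v → v ⊑ w → S u w ≤ (S u v ⊓ᵛ S v w)

module Componentwise {n M : ℕ} {_⊙_ : V n → V n → V n}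
                     (Ws : Fin M → TOSimilaritySpace _⊙_) where
  open TOSimilaritySpace using (Carrier; _⊑_)

  W : Set
  W = (i : Fin M) → Carrier (Ws i)

  S : W → W → V n
  S v w = minᵛ (λ i → TOSimilaritySpace.S (Ws i) (v i) (w i))

  _≤[_]_ : W → Fin M → W → Set
  v ≤[ i ] w = _⊑_ (Ws i) (v i) (w i)

  IsInterval : (i : Fin M) → Pred (Carrier (Ws i)) 0ℓ → Set
  IsInterval i I = Σ (Carrier (Ws i)) λ u → Σ (Carrier (Ws i)) λ v →
    _⊑_ (Ws i) u v ×
    (∀ w → (I w → (_⊑_ (Ws i) u w × _⊑_ (Ws i) w v))
         × ((_⊑_ (Ws i) u w × _⊑_ (Ws i) w v) → I w))

  IsOrthotope : Pred W 0ℓ → Set₁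
  IsOrthotope A = Σ ((i : Fin M) → Pred (Carrier (Ws i)) 0ℓ) λ I →
    (∀ i → IsInterval i (I i)) ×
    (∀ w → (A w → ∀ i → I i (w i)) × ((∀ i → I i (w i)) → A w))

  U : V n → Pred W 0ℓ → Pred W 0ℓ
  U c A w = ∃[ a ] (A a × c ≤ S w a)

-- In a totally ordered similarity space a point p lying between w and a is
-- at least as similar to w as a is.  For two intervals I, J meeting each
-- other, clamping w into the interval I ∩ J gives a point that is either w
-- itself or lies between w and every point of I (or of J); so if w is
-- c-similar to some point of I and to some point of J, it is c-similar to a
-- point of I ∩ J.  Since S on W is the minimum of the component
-- similarities and an orthotope is a product of intervals, the clamping can
-- be done in each component separately.  Neither ⊙ nor the triangle
-- inequality plays any role.
module Submission where

open import Defs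
open import Data.Nat using (ℕ; zero; suc; _≤ᵇ_)
import Data.Nat.Properties as ℕₚ
open import Data.Fin using (Fin; zero; suc; toℕ; _≤_)
open import Data.Fin.Properties using (≤-refl; ≤-trans; ≤fromℕ)
open import Data.Bool using (true; false)
open import Data.Sum using (_⊎_; inj₁; inj₂; [_,_]′)
import Data.Sum as Sum
open import Data.Product using (∃-syntax; Σ; _×_; _,_; proj₁; proj₂; <_,_>)
open import Function using (id)
open import Relation.Unary using (Pred; _∩_; _⊆_; _≐_; Satisfiable)
open import Relation.Nullary.Reflects using (ofʸ; ofⁿ)
open import Relation.Binary.Core using (Rel)
open import Relation.Binary.PropositionalEquality using (_≡_; subst₂)
open import Relation.Binary.Structures using (IsTotalOrder)
open import Level using (0ℓ)

module _ {n : ℕ} where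

  ⊓ᵛ-≤ˡ : (a b : V n) → a ⊓ᵛ b ≤ a
  ⊓ᵛ-≤ˡ a b with toℕ a ≤ᵇ toℕ b | ℕₚ.≤ᵇ-reflects-≤ (toℕ a) (toℕ b)
  ... | true  | ofʸ _   = ≤-refl
  ... | false | ofⁿ a≰b = ℕₚ.<⇒≤ (ℕₚ.≰⇒> a≰b)

  ⊓ᵛ-≤ʳ : (a b : V n) → a ⊓ᵛ b ≤ b
  ⊓ᵛ-≤ʳ a b with toℕ a ≤ᵇ toℕ b | ℕₚ.≤ᵇ-reflects-≤ (toℕ a) (toℕ b)
  ... | true  | ofʸ a≤b = a≤b
  ... | false | ofⁿ _   = ≤-refl

  ⊓ᵛ-glb : {a b c : V n} → c ≤ a → c ≤ b → c ≤ a ⊓ᵛ b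
  ⊓ᵛ-glb {a} {b} c≤a c≤b with toℕ a ≤ᵇ toℕ b
  ... | true  = c≤a
  ... | false = c≤b

  minᵛ-≤ : ∀ {M} (f : Fin M → V n) i → minᵛ f ≤ f i
  minᵛ-≤ f zero    = ⊓ᵛ-≤ˡ (f zero) _
  minᵛ-≤ f (suc i) = ≤-trans (⊓ᵛ-≤ʳ (f zero) _) (minᵛ-≤ (λ j → f (suc j)) i)

  minᵛ-glb : ∀ {M} {c : V n} (f : Fin M → V n) → (∀ i → c ≤ f i) → c ≤ minᵛ f
  minᵛ-glb {M = zero}  {c} f _   = ≤fromℕ c
  minᵛ-glb {M = suc M} f c≤f =
    ⊓ᵛ-glb (c≤f zero) (minᵛ-glb (λ j → f (suc j)) (λ i → c≤f (suc i)))

module TotalOrder {A : Set} {_⊑_ : Rel A 0ℓ} (isTotal : IsTotalOrder _≡_ _⊑_) where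
  open IsTotalOrder isTotal using (total; trans) renaming (refl to ⊑-refl)

  [_,_] : A → A → Pred A 0ℓ
  [ u , v ] p = u ⊑ p × p ⊑ v

  IsInterval : Pred A 0ℓ → Set
  IsInterval I = Σ A λ u → Σ A λ v → u ⊑ v ×
    (∀ w → (I w → (u ⊑ w × w ⊑ v)) × ((u ⊑ w × w ⊑ v) → I w))

  IsInterval⇒≐ : ∀ {I} → IsInterval I → ∃[ u ] ∃[ v ] (I ≐ [ u , v ])
  IsInterval⇒≐ (u , v , _ , I⇔) = u , v , (λ {p} → proj₁ (I⇔ p)) , (λ {p} → proj₂ (I⇔ p))

  Between : A → A → A → Set
  Between w p a = (w ⊑ p × p ⊑ a) ⊎ (a ⊑ p × p ⊑ w)

  BetweenAll : A → A → Pred A 0ℓ → Set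
  BetweenAll w p I = ∀ {a} → I a → Between w p a

  Between-self : ∀ w a → Between w w a
  Between-self w a = Sum.map (⊑-refl ,_) (_, ⊑-refl) (total w a)

  Clamp : A → Pred A 0ℓ → Pred A 0ℓ → Set
  Clamp w I J = ∃[ x ] ((I ∩ J) x × (BetweenAll w x I ⊎ BetweenAll w x J))

  Clamp-swap : ∀ {w I J} → Clamp w I J → Clamp w J I
  Clamp-swap (x , (xI , xJ) , between) = x , (xJ , xI) , Sum.swap between

  Clamp-resp-≐ : ∀ {w I I′ J J′} → I ≐ I′ → J ≐ J′ → Clamp w I′ J′ → Clamp w I J
  Clamp-resp-≐ (I⊆I′ , I′⊆I) (J⊆J′ , J′⊆J) (x , (xI′ , xJ′) , between) =
    x , (I′⊆I xI′ , J′⊆J xJ′) ,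
    Sum.map (λ all aI → all (I⊆I′ aI)) (λ all bJ → all (J⊆J′ bJ)) between

  Satisfiable-swap : ∀ {I J : Pred A 0ℓ} → Satisfiable (I ∩ J) → Satisfiable (J ∩ I)
  Satisfiable-swap (z , zI , zJ) = z , zJ , zI

  module _ {u v u′ v′ : A} where

    clamp-lower : ∀ {w} → u′ ⊑ u → w ⊑ u →
                  Satisfiable ([ u , v ] ∩ [ u′ , v′ ]) → Clamp w [ u , v ] [ u′ , v′ ]
    clamp-lower u′⊑u w⊑u (_ , (u⊑z , z⊑v) , (_ , z⊑v′)) =
      u , ((⊑-refl , trans u⊑z z⊑v) , (u′⊑u , trans u⊑z z⊑v′)) ,
      inj₁ (λ (u⊑a , _) → inj₁ (w⊑u , u⊑a))

    clamp-upper : ∀ {w} → v ⊑ v′ → v ⊑ w →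
                  Satisfiable ([ u , v ] ∩ [ u′ , v′ ]) → Clamp w [ u , v ] [ u′ , v′ ]
    clamp-upper v⊑v′ v⊑w (_ , (u⊑z , z⊑v) , (u′⊑z , _)) =
      v , ((trans u⊑z z⊑v , ⊑-refl) , (trans u′⊑z z⊑v , v⊑v′)) ,
      inj₁ (λ (_ , a⊑v) → inj₂ (a⊑v , v⊑w))

  module _ {u v u′ v′ w : A} (meet : Satisfiable ([ u , v ] ∩ [ u′ , v′ ])) where

    clamp-below : w ⊑ u ⊎ w ⊑ u′ → Clamp w [ u , v ] [ u′ , v′ ]
    clamp-below w⊑ with total u′ u
    ... | inj₁ u′⊑u = clamp-lower u′⊑u ([ id , (λ w⊑u′ → trans w⊑u′ u′⊑u) ]′ w⊑) meet
    ... | inj₂ u⊑u′ = Clamp-swap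
      (clamp-lower u⊑u′ ([ (λ w⊑u → trans w⊑u u⊑u′) , id ]′ w⊑) (Satisfiable-swap meet))

    clamp-above : v ⊑ w ⊎ v′ ⊑ w → Clamp w [ u , v ] [ u′ , v′ ]
    clamp-above ⊑w with total v v′
    ... | inj₁ v⊑v′ = clamp-upper v⊑v′ ([ id , trans v⊑v′ ]′ ⊑w) meet
    ... | inj₂ v′⊑v = Clamp-swap
      (clamp-upper v′⊑v ([ trans v′⊑v , id ]′ ⊑w) (Satisfiable-swap meet))

  clamp : ∀ {u v u′ v′} → Satisfiable ([ u , v ] ∩ [ u′ , v′ ]) →
          ∀ w → Clamp w [ u , v ] [ u′ , v′ ]
  clamp {u} {v} {u′} {v′} meet w with total w u | total w u′
  ... | inj₁ w⊑u | _         = clamp-below meet (inj₁ w⊑u)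
  ... | inj₂ _   | inj₁ w⊑u′ = clamp-below meet (inj₂ w⊑u′)
  ... | inj₂ u⊑w | inj₂ u′⊑w with total v w | total v′ w
  ...   | inj₁ v⊑w | _         = clamp-above meet (inj₁ v⊑w)
  ...   | inj₂ _   | inj₁ v′⊑w = clamp-above meet (inj₂ v′⊑w)
  ...   | inj₂ w⊑v | inj₂ w⊑v′ =
    w , ((u⊑w , w⊑v) , (u′⊑w , w⊑v′)) , inj₁ (λ {a} _ → Between-self w a)

  clamp-interval : ∀ {I J} → IsInterval I → IsInterval J → Satisfiable (I ∩ J) →
                   ∀ w → Clamp w I J
  clamp-interval I-int J-int (z , zI , zJ) w
    with IsInterval⇒≐ I-int | IsInterval⇒≐ J-int
  ... | _ , _ , I≐ | _ , _ , J≐ =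
    Clamp-resp-≐ I≐ J≐ (clamp (z , proj₁ I≐ zI , proj₁ J≐ zJ) w)

module _ {n : ℕ} {_⊙_ : V n → V n → V n} (T : TOSimilaritySpace _⊙_) where
  open TOSimilaritySpace T
  open IsSimilarity isSim using (S-sym)
  open TotalOrder isTotal

  S-Between : ∀ {w p a} → Between w p a → S w a ≤ S w p
  S-Between {p = p} {a} (inj₁ (w⊑p , p⊑a)) = ≤-trans (convex w⊑p p⊑a) (⊓ᵛ-≤ˡ _ (S p a))
  S-Between {w} {p} {a} (inj₂ (a⊑p , p⊑w)) =
    subst₂ _≤_ (S-sym a w) (S-sym p w) (≤-trans (convex a⊑p p⊑w) (⊓ᵛ-≤ʳ (S a p) _))

  clamp-similar : ∀ {I J} → IsInterval I → IsInterval J → Satisfiable (I ∩ J) →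
                  ∀ {c w a b} → I a → J b → c ≤ S w a → c ≤ S w b →
                  ∃[ x ] ((I ∩ J) x × c ≤ S w x)
  clamp-similar I-int J-int meet {w = w} aI bJ c≤wa c≤wb
    with clamp-interval I-int J-int meet w
  ... | x , x∈I∩J , inj₁ betweenI = x , x∈I∩J , ≤-trans c≤wa (S-Between (betweenI aI))
  ... | x , x∈I∩J , inj₂ betweenJ = x , x∈I∩J , ≤-trans c≤wb (S-Between (betweenJ bJ))

module _ {n M : ℕ} {_⊙_ : V n → V n → V n} (Ws : Fin M → TOSimilaritySpace _⊙_) where
  open Componentwise Ws

  S-≤-component : ∀ v w i → S v w ≤ TOSimilaritySpace.S (Ws i) (v i) (w i)
  S-≤-component v w = minᵛ-≤ (λ i → TOSimilaritySpace.S (Ws i) (v i) (w i))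

  U-mono : ∀ {c} {A B : Pred W 0ℓ} → A ⊆ B → U c A ⊆ U c B
  U-mono A⊆B (a , aA , c≤wa) = a , A⊆B aA , c≤wa

  U-∩-⊆ : ∀ {c} {A B : Pred W 0ℓ} → U c (A ∩ B) ⊆ U c A ∩ U c B
  U-∩-⊆ = < U-mono proj₁ , U-mono proj₂ >

  U-∩-⊇ : ∀ {A B : Pred W 0ℓ} → IsOrthotope A → IsOrthotope B → Satisfiable (A ∩ B) →
          ∀ c → U c A ∩ U c B ⊆ U c (A ∩ B)
  U-∩-⊇ (I , I-int , A⇔) (J , J-int , B⇔) (z , zA , zB) c {w}
        ((a , aA , c≤wa) , (b , bB , c≤wb)) =
    x , (proj₂ (A⇔ x) (λ i → proj₁ (x∈I∩J i)) , proj₂ (B⇔ x) (λ i → proj₂ (x∈I∩J i))) ,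
    minᵛ-glb _ (λ i → proj₂ (proj₂ (near i)))
    where
    near : ∀ i → ∃[ x ] ((I i ∩ J i) x × c ≤ TOSimilaritySpace.S (Ws i) (w i) x)
    near i = clamp-similar (Ws i) (I-int i) (J-int i)
      (z i , proj₁ (A⇔ z) zA i , proj₁ (B⇔ z) zB i)
      (proj₁ (A⇔ a) aA i) (proj₁ (B⇔ b) bB i)
      (≤-trans c≤wa (S-≤-component w a i)) (≤-trans c≤wb (S-≤-component w b i))

    x : W
    x i = proj₁ (near i)

    x∈I∩J : ∀ i → (I i ∩ J i) (x i)
    x∈I∩J i = proj₁ (proj₂ (near i))

lemma4p4 : (n M : ℕ) (_⊙_ : V n → V n → V n) → IsConjunction n _⊙_ →
           (Ws : Fin M → TOSimilaritySpace _⊙_) →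
           let open Componentwise Ws in
           (A B : Pred W 0ℓ) → IsOrthotope A → IsOrthotope B →
           ∃[ w ] (A ∩ B) w → (c : V n) →
           U c (A ∩ B) ≐ (U c A ∩ U c B)
lemma4p4 n M _⊙_ _ Ws A B A-orth B-orth meet c =
  U-∩-⊆ Ws , U-∩-⊇ Ws A-orth B-orth meet c
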